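{- Let $G$ be a hypergraph, let $A\subseteq E(G)$ be tri-well-linked in $G$, and let $B\subseteq E(G\triangleleft A)$ be tri-well-linked in $G\triangleleft A$. Then $B\triangleright A$ is tri-well-linked in $G$.
   Context: A hypergraph $G$ consists of finite sets $V(G)$, $E(G)$ and for each hyperedge $e$ a set $V(e)\subseteq V(G)$ (distinct hyperedges may share vertex sets), every vertex lying in some $V(e)$. For $A\subseteq E(G)$: $V(A)=\bigcup_{e\in A}V(e)$, $\overline A=E(G)\setminus A$, $\mathrm{bd}(A)=V(A)\cap V(\overline A)$, $\lambda(A)=|\mathrm{bd}(A)|$ (computed in the hypergraph under consideration). $A$ is tri-well-linked if for every triple $(B_1,B_2,B_3)$ of pairwise disjoint, possibly empty, sets with union $A$, some $i\in\{1,2,3\}$ has $\lambda(B_i)\ge\lambda(A)$. $G\triangleleft A$ is the hypergraph with vertex set $V(\overline A)$ and hyperedge set $\overline A\cup\{e_A\}$ for a new hyperedge $e_A$ with $V(e_A)=\mathrm{bd}(A)$. For $B\subseteq E(G\triangleleft A)$, $B\triangleright A=B$ if $e_A\notin B$, and $B\triangleright A=(B\setminus\{e_A\})\cup A$ if $e_A\in B$. -}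

module Defs where

open import Data.Nat using (ℕ; zero; suc; _≥_)
open import Data.Bool using (Bool; true; false; if_then_else_)
open import Data.Vec using (Vec; []; _∷_; head; tail)
open import Data.Fin using (Fin; zero; suc)
open import Data.Fin.Subset using (Subset; ⊥; _∪_; _∩_; _─_; _∈_; _⊆_; ∣_∣)
open import Data.Product using (Σ; ∃; _×_; _,_)
open import Data.Sum using (_⊎_)
open import Relation.Binary.PropositionalEquality using (_≡_)

-- A finite hypergraph, presented inside ambient index sets Fin n (vertices)
-- and Fin m (hyperedge names).  Its vertex set is the subset V, its hyperedge
-- set is the subset E, and inc e is V(e) (only meaningful for e ∈ E).
record Hypergraph (n m : ℕ) : Set where
  constructor hg
  field
    V   : Subset n
    E   : Subset m
    inc : Fin m → Subset n

open Hypergraph public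

Vof : ∀ {n m} → (Fin m → Subset n) → Subset m → Subset n
Vof {m = zero}  inc []      = ⊥
Vof {m = suc m} inc (b ∷ A) =
  (if b then inc zero else ⊥) ∪ Vof (λ e → inc (suc e)) A

WellFormed : ∀ {n m} → Hypergraph n m → Set
WellFormed G =
  (∀ e → e ∈ E G → inc G e ⊆ V G) ×
  (∀ v → v ∈ V G → ∃ λ e → e ∈ E G × v ∈ inc G e)

compl : ∀ {n m} → Hypergraph n m → Subset m → Subset m
compl G A = E G ─ A

bd : ∀ {n m} → Hypergraph n m → Subset m → Subset n
bd G A = Vof (inc G) A ∩ Vof (inc G) (compl G A)

lam : ∀ {n m} → Hypergraph n m → Subset m → ℕ
lam G A = ∣ bd G A ∣

Disjoint : ∀ {m} → Subset m → Subset m → Set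
Disjoint X Y = X ∩ Y ≡ ⊥

TriWellLinked : ∀ {n m} → Hypergraph n m → Subset m → Set
TriWellLinked G A =
  ∀ (B₁ B₂ B₃ : Subset _) →
  Disjoint B₁ B₂ → Disjoint B₁ B₃ → Disjoint B₂ B₃ →
  B₁ ∪ B₂ ∪ B₃ ≡ A →
  (lam G B₁ ≥ lam G A) ⊎ (lam G B₂ ≥ lam G A) ⊎ (lam G B₃ ≥ lam G A)

-- G ◁ A: hyperedge names Fin (suc m); name zero is the new hyperedge e_A,
-- name suc e is the old hyperedge e.  Hyperedge set {e_A} ∪ Ā,
-- vertex set V(Ā), V(e_A) = bd(A).
_◁_ : ∀ {n m} → Hypergraph n m → Subset m → Hypergraph n (suc m)
G ◁ A = hg (Vof (inc G) (compl G A))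
           (true ∷ compl G A)
           (λ { zero → bd G A ; (suc e) → inc G e })

_▷_ : ∀ {m} → Subset (suc m) → Subset m → Subset m
B ▷ A = if head B then tail B ∪ A else tail B

module Submission where

-- λ is submodular, and symmetric on subsets of E(G), hence posimodular.  Moreover λ in G ◁ A
-- of a set avoiding e_A is λ in G of the same set, and of a set containing e_A it is λ in G of
-- the set with e_A replaced by A.  This settles the case e_A ∉ B.  If e_A ∈ B, let (X₁, X₂, X₃)
-- partition B ▷ A and t = λ(A).  Tri-well-linkedness of A applied to (Xᵢ ∩ A, A ─ Xᵢ, ∅) shows
-- that λ(A ─ Xᵢ) < t forces λ(Xᵢ ∩ A) ≥ t, and posimodularity of A ─ Xᵢ, A ─ Xⱼ then shows that
-- this happens for at most one i.  Together with tri-well-linkedness of A applied to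
-- (Xᵢ ∩ A)ᵢ this yields an i with λ(Xᵢ ∩ A) ≥ t and λ(A ─ Xⱼ) ≥ t for j ≠ i.  Submodularity
-- gives λ(Xᵢ ∪ A) ≤ λ(Xᵢ), posimodularity gives λ(Xⱼ ─ A) ≤ λ(Xⱼ), and tri-well-linkedness of B
-- applied to ({e_A} ∪ (Xᵢ ─ A), Xⱼ ─ A, Xₖ ─ A) finishes the proof.

open import Defs
open import Algebra.Bundles using (CommutativeMonoid)
import Algebra.Properties.CommutativeSemigroup as CommutativeSemigroupProperties
open import Data.Bool using (Bool; true; false; _∧_; _∨_; not; T; if_then_else_)
open import Data.Bool.Properties using (T?; T-≡; ∧-zeroʳ; ∧-identityʳ)
open import Data.Fin using (Fin; zero; suc; #_)
open import Data.Fin.Subset using (Subset; ⊥; _∪_; _∩_; _─_; _∈_; _⊆_; ∣_∣)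
open import Data.Fin.Subset.Properties
  using (⊆-antisym; ⊆-reflexive; anySubset?; p⊆q⇒∣p∣≤∣q∣; p⊆p∪q; q⊆p∪q; p∩q⊆p; p∩q⊆q; p─q⊆p;
         ∪-idem; ∪-identityˡ; ∪-commutativeMonoid; ∪-identityʳ; ∩-zeroˡ; ∩-comm; ∣⊥∣≡0; drop-∷-⊆)
open import Data.List using (List; []; _∷_)
open import Data.List.Relation.Unary.All as All using (All; []; _∷_; all?)
open import Data.Nat using (ℕ; zero; suc; _+_; _≤_; _<_; _≤?_)
open import Data.Nat.Properties
  using (≤-trans; ≤-reflexive; <-≤-trans; +-comm; +-suc; +-cancelˡ-≤; +-monoˡ-≤; +-mono-≤; +-mono-<;
         <⇒≱; ≰⇒>; n≮0; module ≤-Reasoning)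
open import Data.Product using (∃; _×_; _,_; proj₁; proj₂)
open import Data.Sum as Sum using (_⊎_; inj₁; inj₂; swap; assocʳ; assocˡ; map₁)
open import Data.Vec using (Vec; []; _∷_; lookup; map)
open import Data.Vec.Properties
  using (lookup-map; lookup-zipWith; lookup-replicate; []=⇒lookup; lookup⇒[]=)
open import Function using (_∘_; _⇔_; mk⇔; Equivalence)
open import Relation.Binary.PropositionalEquality
  using (_≡_; refl; sym; trans; cong; cong₂; subst₂; module ≡-Reasoning)
open import Relation.Nullary using (¬_; Dec; yes; no; ¬?; _×-dec_; _→-dec_; contradiction)
open import Relation.Nullary.Decidable using (False; toWitnessFalse; decidable-stable)

infixr 9 _∩ₜ_
infixr 8 _∪ₜ_
infixl 7 _─ₜ_
infix 6 _≐_ _⊑_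

data Term (k : ℕ) : Set where
  var : Fin k → Term k
  ∅ₜ : Term k
  _∪ₜ_ _∩ₜ_ _─ₜ_ : Term k → Term k → Term k

⟦_⟧ : ∀ {k m} → Term k → Vec (Subset m) k → Subset m
⟦ var j ⟧ ρ = lookup ρ j
⟦ ∅ₜ ⟧ ρ = ⊥
⟦ s ∪ₜ t ⟧ ρ = ⟦ s ⟧ ρ ∪ ⟦ t ⟧ ρ
⟦ s ∩ₜ t ⟧ ρ = ⟦ s ⟧ ρ ∩ ⟦ t ⟧ ρ
⟦ s ─ₜ t ⟧ ρ = ⟦ s ⟧ ρ ─ ⟦ t ⟧ ρ

evalAt : ∀ {k} → Term k → Subset k → Bool
evalAt (var j) β = lookup β j
evalAt ∅ₜ β = false
evalAt (s ∪ₜ t) β = evalAt s β ∨ evalAt t β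
evalAt (s ∩ₜ t) β = evalAt s β ∧ evalAt t β
evalAt (s ─ₜ t) β = evalAt s β ∧ not (evalAt t β)

data Fact (k : ℕ) : Set where
  _≐_ _⊑_ : Term k → Term k → Fact k

Holds : ∀ {k m} → Vec (Subset m) k → Fact k → Set
Holds ρ (s ≐ t) = ⟦ s ⟧ ρ ≡ ⟦ t ⟧ ρ
Holds ρ (s ⊑ t) = ⟦ s ⟧ ρ ⊆ ⟦ t ⟧ ρ

_⇒at_ : ∀ {k} → Term k → Term k → Subset k → Set
(s ⇒at t) β = T (evalAt s β) → T (evalAt t β)

HoldsAt : ∀ {k} → Subset k → Fact k → Set
HoldsAt β (s ≐ t) = (s ⇒at t) β × (t ⇒at s) β
HoldsAt β (s ⊑ t) = (s ⇒at t) β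

⇒at? : ∀ {k} (s t : Term k) β → Dec ((s ⇒at t) β)
⇒at? s t β = T? (evalAt s β) →-dec T? (evalAt t β)

holdsAt? : ∀ {k} β (φ : Fact k) → Dec (HoldsAt β φ)
holdsAt? β (s ≐ t) = ⇒at? s t β ×-dec ⇒at? t s β
holdsAt? β (s ⊑ t) = ⇒at? s t β

column : ∀ {k m} → Vec (Subset m) k → Fin m → Subset k
column ρ x = map (λ S → lookup S x) ρ

lookup-─ : ∀ {m} (p q : Subset m) x → lookup (p ─ q) x ≡ lookup p x ∧ not (lookup q x)
lookup-─ (a ∷ p) (true ∷ q) zero = sym (∧-zeroʳ a)
lookup-─ (a ∷ p) (false ∷ q) zero = sym (∧-identityʳ a)
lookup-─ (_ ∷ p) (_ ∷ q) (suc x) = lookup-─ p q x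

lookup-⟦⟧ : ∀ {k m} (t : Term k) (ρ : Vec (Subset m) k) x → lookup (⟦ t ⟧ ρ) x ≡ evalAt t (column ρ x)
lookup-⟦⟧ (var j) ρ x = sym (lookup-map j (λ S → lookup S x) ρ)
lookup-⟦⟧ ∅ₜ ρ x = lookup-replicate x false
lookup-⟦⟧ (s ∪ₜ t) ρ x =
  trans (lookup-zipWith _∨_ x (⟦ s ⟧ ρ) (⟦ t ⟧ ρ)) (cong₂ _∨_ (lookup-⟦⟧ s ρ x) (lookup-⟦⟧ t ρ x))
lookup-⟦⟧ (s ∩ₜ t) ρ x =
  trans (lookup-zipWith _∧_ x (⟦ s ⟧ ρ) (⟦ t ⟧ ρ)) (cong₂ _∧_ (lookup-⟦⟧ s ρ x) (lookup-⟦⟧ t ρ x))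
lookup-⟦⟧ (s ─ₜ t) ρ x =
  trans (lookup-─ (⟦ s ⟧ ρ) (⟦ t ⟧ ρ) x) (cong₂ (λ a b → a ∧ not b) (lookup-⟦⟧ s ρ x) (lookup-⟦⟧ t ρ x))

∈⟦⟧⇔ : ∀ {k m} (t : Term k) (ρ : Vec (Subset m) k) x → x ∈ ⟦ t ⟧ ρ ⇔ T (evalAt t (column ρ x))
∈⟦⟧⇔ t ρ x = mk⇔
  (λ x∈t → Equivalence.from T-≡ (trans (sym (lookup-⟦⟧ t ρ x)) ([]=⇒lookup x∈t)))
  (λ Tt → lookup⇒[]= x _ (trans (lookup-⟦⟧ t ρ x) (Equivalence.to T-≡ Tt)))

module _ {k m} (ρ : Vec (Subset m) k) where

  ⊆⇒at : ∀ s t → ⟦ s ⟧ ρ ⊆ ⟦ t ⟧ ρ → ∀ x → (s ⇒at t) (column ρ x)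
  ⊆⇒at s t s⊆t x = Equivalence.to (∈⟦⟧⇔ t ρ x) ∘ s⊆t ∘ Equivalence.from (∈⟦⟧⇔ s ρ x)

  at⇒⊆ : ∀ s t → (∀ x → (s ⇒at t) (column ρ x)) → ⟦ s ⟧ ρ ⊆ ⟦ t ⟧ ρ
  at⇒⊆ s t h {x} = Equivalence.from (∈⟦⟧⇔ t ρ x) ∘ h x ∘ Equivalence.to (∈⟦⟧⇔ s ρ x)

  holds⇒holdsAt : ∀ φ → Holds ρ φ → ∀ x → HoldsAt (column ρ x) φ
  holds⇒holdsAt (s ≐ t) s≡t x = ⊆⇒at s t (⊆-reflexive s≡t) x , ⊆⇒at t s (⊆-reflexive (sym s≡t)) x
  holds⇒holdsAt (s ⊑ t) = ⊆⇒at s t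

  holdsAt⇒holds : ∀ φ → (∀ x → HoldsAt (column ρ x) φ) → Holds ρ φ
  holdsAt⇒holds (s ≐ t) h = ⊆-antisym (at⇒⊆ s t (proj₁ ∘ h)) (at⇒⊆ t s (proj₂ ∘ h))
  holdsAt⇒holds (s ⊑ t) = at⇒⊆ s t

EntailsAt : ∀ {k} → List (Fact k) → Fact k → Subset k → Set
EntailsAt hs φ β = All (HoldsAt β) hs → HoldsAt β φ

entailsAt? : ∀ {k} (hs : List (Fact k)) (φ : Fact k) β → Dec (EntailsAt hs φ β)
entailsAt? hs φ β = all? (holdsAt? β) hs →-dec holdsAt? β φ

counterexample? : ∀ {k} (hs : List (Fact k)) (φ : Fact k) → Dec (∃ λ β → ¬ EntailsAt hs φ β)
counterexample? hs φ = anySubset? (¬? ∘ entailsAt? hs φ)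

-- A Boolean combination of subsets is determined elementwise, so a fact follows from
-- hypotheses as soon as it does in the two-element Boolean algebra.
by-truth-table : ∀ {k m} (hs : List (Fact k)) (φ : Fact k) {_ : False (counterexample? hs φ)} →
  (ρ : Vec (Subset m) k) → All (Holds ρ) hs → Holds ρ φ
by-truth-table hs φ {none} ρ hyps = holdsAt⇒holds ρ φ λ x →
  decidable-stable (entailsAt? hs φ (column ρ x)) (λ ¬entailed → toWitnessFalse none (column ρ x , ¬entailed))
    (All.map (λ {ψ} h → holds⇒holdsAt ρ ψ h x) hyps)

∣∪∣+∣∩∣ : ∀ {n} (p q : Subset n) → ∣ p ∪ q ∣ + ∣ p ∩ q ∣ ≡ ∣ p ∣ + ∣ q ∣
∣∪∣+∣∩∣ [] [] = refl
∣∪∣+∣∩∣ (true ∷ p) (true ∷ q) =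
  cong suc (trans (+-suc _ _) (trans (cong suc (∣∪∣+∣∩∣ p q)) (sym (+-suc _ _))))
∣∪∣+∣∩∣ (true ∷ p) (false ∷ q) = cong suc (∣∪∣+∣∩∣ p q)
∣∪∣+∣∩∣ (false ∷ p) (true ∷ q) = trans (cong suc (∣∪∣+∣∩∣ p q)) (sym (+-suc _ _))
∣∪∣+∣∩∣ (false ∷ p) (false ∷ q) = ∣∪∣+∣∩∣ p q

∣∣+∣∣-mono : ∀ {n} {p q r s : Subset n} → r ∪ s ⊆ p ∪ q → r ∩ s ⊆ p ∩ q → ∣ r ∣ + ∣ s ∣ ≤ ∣ p ∣ + ∣ q ∣
∣∣+∣∣-mono {p = p} {q} {r} {s} ∪⊆ ∩⊆ = begin
  ∣ r ∣ + ∣ s ∣          ≡⟨ sym (∣∪∣+∣∩∣ r s) ⟩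
  ∣ r ∪ s ∣ + ∣ r ∩ s ∣  ≤⟨ +-mono-≤ (p⊆q⇒∣p∣≤∣q∣ ∪⊆) (p⊆q⇒∣p∣≤∣q∣ ∩⊆) ⟩
  ∣ p ∪ q ∣ + ∣ p ∩ q ∣  ≡⟨ ∣∪∣+∣∩∣ p q ⟩
  ∣ p ∣ + ∣ q ∣          ∎
  where open ≤-Reasoning

+-cancel-≤ : ∀ {a b c d} → a + b ≤ c + d → d ≤ a → b ≤ c
+-cancel-≤ {a} {b} {c} {d} h d≤a =
  +-cancelˡ-≤ d b c (≤-trans (+-monoˡ-≤ b d≤a) (≤-trans h (≤-reflexive (+-comm c d))))

module ∪ {n} =
  CommutativeSemigroupProperties (CommutativeMonoid.commutativeSemigroup (∪-commutativeMonoid n))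

if-∨-∪ : ∀ {n} x y (I : Subset n) →
  (if x ∨ y then I else ⊥) ≡ (if x then I else ⊥) ∪ (if y then I else ⊥)
if-∨-∪ true true I = sym (∪-idem I)
if-∨-∪ true false I = sym (∪-identityʳ I)
if-∨-∪ false y I = sym (∪-identityˡ _)

Vof-∪ : ∀ {n m} (inc : Fin m → Subset n) X Y → Vof inc (X ∪ Y) ≡ Vof inc X ∪ Vof inc Y
Vof-∪ {m = zero} inc [] [] = sym (∪-idem ⊥)
Vof-∪ {m = suc m} inc (x ∷ X) (y ∷ Y) = begin
  edge (x ∨ y) ∪ V′ (X ∪ Y)          ≡⟨ cong₂ _∪_ (if-∨-∪ x y (inc zero)) (Vof-∪ (inc ∘ suc) X Y) ⟩
  (edge x ∪ edge y) ∪ (V′ X ∪ V′ Y)  ≡⟨ ∪.interchange (edge x) (edge y) (V′ X) (V′ Y) ⟩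
  (edge x ∪ V′ X) ∪ (edge y ∪ V′ Y)  ∎
  where
  open ≡-Reasoning
  edge : Bool → Subset _
  edge b = if b then inc zero else ⊥
  V′ : Subset m → Subset _
  V′ = Vof (inc ∘ suc)

Vof-⊥ : ∀ {n m} (inc : Fin m → Subset n) → Vof inc ⊥ ≡ ⊥
Vof-⊥ {m = zero} inc = refl
Vof-⊥ {m = suc m} inc = trans (∪-identityˡ _) (Vof-⊥ (inc ∘ suc))

Vof-mono : ∀ {n m} (inc : Fin m → Subset n) {X Y} → X ⊆ Y → Vof inc X ⊆ Vof inc Y
Vof-mono inc {X} {Y} X⊆Y = ⊆-reflexive (trans (sym (Vof-∪ inc X Y)) (cong (Vof inc) X∪Y≡Y)) ∘ p⊆p∪q _
  where
  X∪Y≡Y : X ∪ Y ≡ Y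
  X∪Y≡Y = by-truth-table (var (# 0) ⊑ var (# 1) ∷ []) (var (# 0) ∪ₜ var (# 1) ≐ var (# 1))
            (X ∷ Y ∷ []) (X⊆Y ∷ [])

Vof-⊆-∪ : ∀ {n m} (inc : Fin m → Subset n) {Z X Y} → Z ⊆ X ∪ Y → Vof inc Z ⊆ Vof inc X ∪ Vof inc Y
Vof-⊆-∪ inc {X = X} {Y} Z⊆X∪Y = ⊆-reflexive (Vof-∪ inc X Y) ∘ Vof-mono inc Z⊆X∪Y

module _ {n m} (G : Hypergraph n m) where

  private
    V⟨_⟩ : Subset m → Subset n
    V⟨_⟩ = Vof (inc G)

  lam-⊥ : lam G ⊥ ≡ 0
  lam-⊥ = trans (cong ∣_∣ (trans (cong (_∩ V⟨ E G ─ ⊥ ⟩) (Vof-⊥ (inc G))) (∩-zeroˡ _))) (∣⊥∣≡0 n)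

  lam-submodular : ∀ X Y → lam G (X ∩ Y) + lam G (X ∪ Y) ≤ lam G X + lam G Y
  lam-submodular X Y = ∣∣+∣∣-mono ∪-bound ∩-bound
    where
    x y e : Term 3
    x = var (# 0)
    y = var (# 1)
    e = var (# 2)
    sets : (φ : Fact 3) {_ : False (counterexample? [] φ)} → Holds (X ∷ Y ∷ E G ∷ []) φ
    sets φ {c} = by-truth-table [] φ {c} _ []

    V[X] V[E─X] V[Y] V[E─Y] V[X∩Y] V[E─X∩Y] V[X∪Y] V[E─X∪Y] : Term 8
    V[X]     = var (# 0)
    V[E─X]   = var (# 1)
    V[Y]     = var (# 2)
    V[E─Y]   = var (# 3)
    V[X∩Y]   = var (# 4)
    V[E─X∩Y] = var (# 5)
    V[X∪Y]   = var (# 6)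
    V[E─X∪Y] = var (# 7)
    ρ : Vec (Subset n) 8
    ρ = V⟨ X ⟩ ∷ V⟨ E G ─ X ⟩ ∷ V⟨ Y ⟩ ∷ V⟨ E G ─ Y ⟩
      ∷ V⟨ X ∩ Y ⟩ ∷ V⟨ E G ─ (X ∩ Y) ⟩ ∷ V⟨ X ∪ Y ⟩ ∷ V⟨ E G ─ (X ∪ Y) ⟩ ∷ []
    incidences : List (Fact 8)
    incidences =
      V[X∩Y] ⊑ V[X] ∷ V[X∩Y] ⊑ V[Y] ∷ V[E─X∩Y] ⊑ V[E─X] ∪ₜ V[E─Y] ∷
      V[X∪Y] ⊑ V[X] ∪ₜ V[Y] ∷ V[E─X∪Y] ⊑ V[E─X] ∷ V[E─X∪Y] ⊑ V[E─Y] ∷ []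
    vertices : (φ : Fact 8) {_ : False (counterexample? incidences φ)} → Holds ρ φ
    vertices φ {c} = by-truth-table incidences φ {c} ρ
      ( Vof-mono (inc G) (p∩q⊆p X Y)
      ∷ Vof-mono (inc G) (p∩q⊆q X Y)
      ∷ Vof-⊆-∪ (inc G) (sets (e ─ₜ x ∩ₜ y ⊑ (e ─ₜ x) ∪ₜ (e ─ₜ y)))
      ∷ ⊆-reflexive (Vof-∪ (inc G) X Y)
      ∷ Vof-mono (inc G) (sets (e ─ₜ (x ∪ₜ y) ⊑ e ─ₜ x))
      ∷ Vof-mono (inc G) (sets (e ─ₜ (x ∪ₜ y) ⊑ e ─ₜ y))
      ∷ [])
    ∪-bound : bd G (X ∩ Y) ∪ bd G (X ∪ Y) ⊆ bd G X ∪ bd G Y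
    ∪-bound = vertices ((V[X∩Y] ∩ₜ V[E─X∩Y]) ∪ₜ (V[X∪Y] ∩ₜ V[E─X∪Y])
                        ⊑ (V[X] ∩ₜ V[E─X]) ∪ₜ (V[Y] ∩ₜ V[E─Y]))
    ∩-bound : bd G (X ∩ Y) ∩ bd G (X ∪ Y) ⊆ bd G X ∩ bd G Y
    ∩-bound = vertices ((V[X∩Y] ∩ₜ V[E─X∩Y]) ∩ₜ (V[X∪Y] ∩ₜ V[E─X∪Y])
                        ⊑ (V[X] ∩ₜ V[E─X]) ∩ₜ (V[Y] ∩ₜ V[E─Y]))

  lam-compl : ∀ {X} → X ⊆ E G → lam G (E G ─ X) ≡ lam G X
  lam-compl {X} X⊆E = cong ∣_∣ (trans (cong (λ W → V⟨ E G ─ X ⟩ ∩ V⟨ W ⟩) E─[E─X]≡X) (∩-comm _ _))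
    where
    E─[E─X]≡X : E G ─ (E G ─ X) ≡ X
    E─[E─X]≡X = by-truth-table (var (# 0) ⊑ var (# 1) ∷ [])
                  (var (# 1) ─ₜ (var (# 1) ─ₜ var (# 0)) ≐ var (# 0)) (X ∷ E G ∷ []) (X⊆E ∷ [])

  -- Posimodularity of a symmetric submodular function: apply submodularity to X and E ─ Y.
  lam-posimodular : ∀ {X Y} → X ⊆ E G → Y ⊆ E G → lam G (X ─ Y) + lam G (Y ─ X) ≤ lam G X + lam G Y
  lam-posimodular {X} {Y} X⊆E Y⊆E = begin
    lam G (X ─ Y) + lam G (Y ─ X)          ≡⟨ cong₂ _+_ (cong (lam G) (sets (x ─ₜ y ≐ x ∩ₜ (e ─ₜ y))))
                                                        (cong (lam G) (sets (y ─ₜ x ≐ e ─ₜ (x ∪ₜ (e ─ₜ y))))) ⟩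
    lam G (X ∩ Ȳ) + lam G (E G ─ (X ∪ Ȳ))  ≡⟨ cong (lam G (X ∩ Ȳ) +_) (lam-compl (sets (x ∪ₜ (e ─ₜ y) ⊑ e))) ⟩
    lam G (X ∩ Ȳ) + lam G (X ∪ Ȳ)          ≤⟨ lam-submodular X Ȳ ⟩
    lam G X + lam G Ȳ                      ≡⟨ cong (lam G X +_) (lam-compl Y⊆E) ⟩
    lam G X + lam G Y                      ∎
    where
    open ≤-Reasoning
    Ȳ : Subset m
    Ȳ = E G ─ Y
    x y e : Term 3
    x = var (# 0)
    y = var (# 1)
    e = var (# 2)
    sets : (φ : Fact 3) {_ : False (counterexample? (x ⊑ e ∷ y ⊑ e ∷ []) φ)} → Holds (X ∷ Y ∷ E G ∷ []) φ
    sets φ {c} = by-truth-table _ φ {c} _ (X⊆E ∷ Y⊆E ∷ [])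

  lam-∪≤lam : ∀ {X A} → lam G A ≤ lam G (X ∩ A) → lam G (X ∪ A) ≤ lam G X
  lam-∪≤lam {X} {A} t≤p = +-cancel-≤ (lam-submodular X A) t≤p

  lam-─≤lam : ∀ {X A} → X ⊆ E G → A ⊆ E G → lam G A ≤ lam G (A ─ X) → lam G (X ─ A) ≤ lam G X
  lam-─≤lam {X} {A} X⊆E A⊆E t≤q =
    +-cancel-≤ (≤-trans (≤-reflexive (+-comm (lam G (A ─ X)) _)) (lam-posimodular X⊆E A⊆E)) t≤q

  -- In G ◁ A the new hyperedge has V(e_A) = bd A, and the complement of h ∷ D is (not h) ∷ W.
  lam-◁-eA : ∀ A D → lam (G ◁ A) (true ∷ D) ≡ lam G (D ∪ A)
  lam-◁-eA A D = cong ∣_∣ (vertices ((V[A] ∩ₜ V[E─A] ∪ₜ V[D]) ∩ₜ (∅ₜ ∪ₜ V[W]) ≐ V[D∪A] ∩ₜ V[E─D∪A]))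
    where
    W : Subset m
    W = E G ─ A ─ D
    V[A] V[E─A] V[D] V[W] V[D∪A] V[E─D∪A] : Term 6
    V[A]     = var (# 0)
    V[E─A]   = var (# 1)
    V[D]     = var (# 2)
    V[W]     = var (# 3)
    V[D∪A]   = var (# 4)
    V[E─D∪A] = var (# 5)
    ρ : Vec (Subset n) 6
    ρ = V⟨ A ⟩ ∷ V⟨ E G ─ A ⟩ ∷ V⟨ D ⟩ ∷ V⟨ W ⟩ ∷ V⟨ D ∪ A ⟩ ∷ V⟨ E G ─ (D ∪ A) ⟩ ∷ []
    incidences : List (Fact 6)
    incidences = V[D∪A] ≐ V[D] ∪ₜ V[A] ∷ V[E─D∪A] ≐ V[W] ∷ V[W] ⊑ V[E─A] ∷ []
    E─[D∪A]≡W : E G ─ (D ∪ A) ≡ W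
    E─[D∪A]≡W = by-truth-table []
                  (var (# 2) ─ₜ (var (# 1) ∪ₜ var (# 0)) ≐ var (# 2) ─ₜ var (# 0) ─ₜ var (# 1))
                  (A ∷ D ∷ E G ∷ []) []
    vertices : (φ : Fact 6) {_ : False (counterexample? incidences φ)} → Holds ρ φ
    vertices φ {c} = by-truth-table incidences φ {c} ρ
      (Vof-∪ (inc G) D A ∷ cong V⟨_⟩ E─[D∪A]≡W ∷ Vof-mono (inc G) (p─q⊆p _ D) ∷ [])

  lam-◁ : ∀ {A D} → A ⊆ E G → D ⊆ E G ─ A → lam (G ◁ A) (false ∷ D) ≡ lam G D
  lam-◁ {A} {D} A⊆E D⊆E─A =
    cong ∣_∣ (vertices ((∅ₜ ∪ₜ V[D]) ∩ₜ (V[A] ∩ₜ V[E─A] ∪ₜ V[W]) ≐ V[D] ∩ₜ V[E─D]))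
    where
    W : Subset m
    W = E G ─ A ─ D
    a d e : Term 3
    a = var (# 0)
    d = var (# 1)
    e = var (# 2)
    sets : (φ : Fact 3) {_ : False (counterexample? (a ⊑ e ∷ d ⊑ e ─ₜ a ∷ []) φ)} →
      Holds (A ∷ D ∷ E G ∷ []) φ
    sets φ {c} = by-truth-table _ φ {c} _ (A⊆E ∷ D⊆E─A ∷ [])
    V[A] V[E─A] V[D] V[W] V[E─D] : Term 5
    V[A]   = var (# 0)
    V[E─A] = var (# 1)
    V[D]   = var (# 2)
    V[W]   = var (# 3)
    V[E─D] = var (# 4)
    ρ : Vec (Subset n) 5
    ρ = V⟨ A ⟩ ∷ V⟨ E G ─ A ⟩ ∷ V⟨ D ⟩ ∷ V⟨ W ⟩ ∷ V⟨ E G ─ D ⟩ ∷ []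
    incidences : List (Fact 5)
    incidences = V[A] ⊑ V[E─D] ∷ V[W] ⊑ V[E─D] ∷ V[E─D] ⊑ V[W] ∪ₜ V[A] ∷ V[D] ⊑ V[E─A] ∷ []
    vertices : (φ : Fact 5) {_ : False (counterexample? incidences φ)} → Holds ρ φ
    vertices φ {c} = by-truth-table incidences φ {c} ρ
      ( Vof-mono (inc G) (sets (a ⊑ e ─ₜ d))
      ∷ Vof-mono (inc G) (sets (e ─ₜ a ─ₜ d ⊑ e ─ₜ d))
      ∷ Vof-⊆-∪ (inc G) (sets (e ─ₜ d ⊑ (e ─ₜ a ─ₜ d) ∪ₜ a))
      ∷ Vof-mono (inc G) D⊆E─A
      ∷ [])

  lam-◁-eA-─ : ∀ {A X} → lam G A ≤ lam G (X ∩ A) → lam (G ◁ A) (true ∷ (X ─ A)) ≤ lam G X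
  lam-◁-eA-─ {A} {X} t≤p = begin
    lam (G ◁ A) (true ∷ (X ─ A))   ≡⟨ lam-◁-eA A (X ─ A) ⟩
    lam G ((X ─ A) ∪ A)            ≡⟨ cong (lam G) (by-truth-table [] ((x ─ₜ a) ∪ₜ a ≐ x ∪ₜ a) (X ∷ A ∷ []) []) ⟩
    lam G (X ∪ A)                  ≤⟨ lam-∪≤lam t≤p ⟩
    lam G X                        ∎
    where
    open ≤-Reasoning
    x a : Term 2
    x = var (# 0)
    a = var (# 1)

  lam-◁-─ : ∀ {A X} → A ⊆ E G → X ⊆ E G → lam G A ≤ lam G (A ─ X) →
    lam (G ◁ A) (false ∷ (X ─ A)) ≤ lam G X
  lam-◁-─ {A} {X} A⊆E X⊆E t≤q = begin
    lam (G ◁ A) (false ∷ (X ─ A))  ≡⟨ lam-◁ A⊆E X─A⊆E─A ⟩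
    lam G (X ─ A)                  ≤⟨ lam-─≤lam X⊆E A⊆E t≤q ⟩
    lam G X                        ∎
    where
    open ≤-Reasoning
    X─A⊆E─A : X ─ A ⊆ E G ─ A
    X─A⊆E─A = by-truth-table (var (# 0) ⊑ var (# 2) ∷ []) (var (# 0) ─ₜ var (# 1) ⊑ var (# 2) ─ₜ var (# 1))
                (X ∷ A ∷ E G ∷ []) (X⊆E ∷ [])

twl-bipartition : ∀ {n m} (G : Hypergraph n m) {A X} → TriWellLinked G A →
  lam G (A ─ X) < lam G A → lam G A ≤ lam G (X ∩ A)
twl-bipartition G {A} {X} twlA q<t
  with twlA (X ∩ A) (A ─ X) ⊥ (sets ((x ∩ₜ a) ∩ₜ (a ─ₜ x) ≐ ∅ₜ)) (sets ((x ∩ₜ a) ∩ₜ ∅ₜ ≐ ∅ₜ))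
         (sets ((a ─ₜ x) ∩ₜ ∅ₜ ≐ ∅ₜ)) (sets (x ∩ₜ a ∪ₜ (a ─ₜ x) ∪ₜ ∅ₜ ≐ a))
  where
  x a : Term 2
  x = var (# 0)
  a = var (# 1)
  sets : (φ : Fact 2) {_ : False (counterexample? [] φ)} → Holds (X ∷ A ∷ []) φ
  sets φ {c} = by-truth-table [] φ {c} _ []
... | inj₁ t≤p = t≤p
... | inj₂ (inj₁ t≤q) = contradiction t≤q (<⇒≱ q<t)
... | inj₂ (inj₂ t≤λ⊥) = contradiction (<-≤-trans q<t (≤-trans t≤λ⊥ (≤-reflexive (lam-⊥ G)))) n≮0

-- X can take over all of A, at the expense of Y and Z.
Absorbs : ∀ {n m} → Hypergraph n m → (A X Y Z : Subset m) → Set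
Absorbs G A X Y Z = lam G A ≤ lam G (X ∩ A) × lam G A ≤ lam G (A ─ Y) × lam G A ≤ lam G (A ─ Z)

module _ {n m} (G : Hypergraph n m) {A : Subset m} (A⊆E : A ⊆ E G) where

  module _ (twlA : TriWellLinked G A) where

    twl-─<-unique : ∀ {X Y} → Disjoint X Y → lam G (A ─ X) < lam G A → lam G A ≤ lam G (A ─ Y)
    twl-─<-unique {X} {Y} X∩Y≡⊥ qX<t with lam G A ≤? lam G (A ─ Y)
    ... | yes t≤qY = t≤qY
    ... | no t≰qY = begin-contradiction
      lam G (Y ∩ A) + lam G (X ∩ A)
        ≡⟨ cong₂ _+_ (cong (lam G) (sets (y ∩ₜ a ≐ (a ─ₜ x) ─ₜ (a ─ₜ y))))
                     (cong (lam G) (sets (x ∩ₜ a ≐ (a ─ₜ y) ─ₜ (a ─ₜ x)))) ⟩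
      lam G ((A ─ X) ─ (A ─ Y)) + lam G ((A ─ Y) ─ (A ─ X))
        ≤⟨ lam-posimodular G (sets (a ─ₜ x ⊑ e)) (sets (a ─ₜ y ⊑ e)) ⟩
      lam G (A ─ X) + lam G (A ─ Y)
        <⟨ +-mono-< qX<t qY<t ⟩
      lam G A + lam G A
        ≤⟨ +-mono-≤ (twl-bipartition G twlA qY<t) (twl-bipartition G twlA qX<t) ⟩
      lam G (Y ∩ A) + lam G (X ∩ A)
        ∎
      where
      open ≤-Reasoning
      qY<t : lam G (A ─ Y) < lam G A
      qY<t = ≰⇒> t≰qY
      x y a e : Term 4
      x = var (# 0)
      y = var (# 1)
      a = var (# 2)
      e = var (# 3)
      sets : (φ : Fact 4) {_ : False (counterexample? (x ∩ₜ y ≐ ∅ₜ ∷ a ⊑ e ∷ []) φ)} →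
        Holds (X ∷ Y ∷ A ∷ E G ∷ []) φ
      sets φ {c} = by-truth-table _ φ {c} _ (X∩Y≡⊥ ∷ A⊆E ∷ [])

    twl-absorbs : ∀ {X₁ X₂ X₃} → Disjoint X₁ X₂ → Disjoint X₁ X₃ → Disjoint X₂ X₃ → A ⊆ X₁ ∪ X₂ ∪ X₃ →
      Absorbs G A X₁ X₂ X₃ ⊎ Absorbs G A X₂ X₁ X₃ ⊎ Absorbs G A X₃ X₁ X₂
    twl-absorbs {X₁} {X₂} {X₃} d₁₂ d₁₃ d₂₃ A⊆X
      with lam G A ≤? lam G (A ─ X₁) | lam G A ≤? lam G (A ─ X₂) | lam G A ≤? lam G (A ─ X₃)
    ... | no t≰q₁ | _ | _ =
      inj₁ (twl-bipartition G twlA (≰⇒> t≰q₁) ,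
            twl-─<-unique d₁₂ (≰⇒> t≰q₁) , twl-─<-unique d₁₃ (≰⇒> t≰q₁))
    ... | yes t≤q₁ | no t≰q₂ | _ =
      inj₂ (inj₁ (twl-bipartition G twlA (≰⇒> t≰q₂) , t≤q₁ , twl-─<-unique d₂₃ (≰⇒> t≰q₂)))
    ... | yes t≤q₁ | yes t≤q₂ | no t≰q₃ =
      inj₂ (inj₂ (twl-bipartition G twlA (≰⇒> t≰q₃) , t≤q₁ , t≤q₂))
    ... | yes t≤q₁ | yes t≤q₂ | yes t≤q₃ =
      Sum.map (λ t≤p₁ → t≤p₁ , t≤q₂ , t≤q₃)
        (Sum.map (λ t≤p₂ → t≤p₂ , t≤q₁ , t≤q₃) (λ t≤p₃ → t≤p₃ , t≤q₁ , t≤q₂))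
        (twlA (X₁ ∩ A) (X₂ ∩ A) (X₃ ∩ A)
              (sets ((x₁ ∩ₜ a) ∩ₜ (x₂ ∩ₜ a) ≐ ∅ₜ)) (sets ((x₁ ∩ₜ a) ∩ₜ (x₃ ∩ₜ a) ≐ ∅ₜ))
              (sets ((x₂ ∩ₜ a) ∩ₜ (x₃ ∩ₜ a) ≐ ∅ₜ)) (sets (x₁ ∩ₜ a ∪ₜ x₂ ∩ₜ a ∪ₜ x₃ ∩ₜ a ≐ a)))
      where
      x₁ x₂ x₃ a : Term 4
      x₁ = var (# 0)
      x₂ = var (# 1)
      x₃ = var (# 2)
      a  = var (# 3)
      known : List (Fact 4)
      known = x₁ ∩ₜ x₂ ≐ ∅ₜ ∷ x₁ ∩ₜ x₃ ≐ ∅ₜ ∷ x₂ ∩ₜ x₃ ≐ ∅ₜ ∷ a ⊑ x₁ ∪ₜ x₂ ∪ₜ x₃ ∷ []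
      sets : (φ : Fact 4) {_ : False (counterexample? known φ)} → Holds (X₁ ∷ X₂ ∷ X₃ ∷ A ∷ []) φ
      sets φ {c} = by-truth-table _ φ {c} _ (d₁₂ ∷ d₁₃ ∷ d₂₃ ∷ A⊆X ∷ [])

  module _ {B : Subset m} (B⊆E─A : B ⊆ E G ─ A) where

    twl-◁ : TriWellLinked (G ◁ A) (false ∷ B) → TriWellLinked G B
    twl-◁ twlB X₁ X₂ X₃ d₁₂ d₁₃ d₂₃ cover =
      Sum.map (transfer (sets (x₁ ⊑ b))) (Sum.map (transfer (sets (x₂ ⊑ b))) (transfer (sets (x₃ ⊑ b))))
        (twlB (false ∷ X₁) (false ∷ X₂) (false ∷ X₃)
              (cong (false ∷_) d₁₂) (cong (false ∷_) d₁₃) (cong (false ∷_) d₂₃) (cong (false ∷_) cover))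
      where
      x₁ x₂ x₃ b : Term 4
      x₁ = var (# 0)
      x₂ = var (# 1)
      x₃ = var (# 2)
      b  = var (# 3)
      sets : (φ : Fact 4) {_ : False (counterexample? (x₁ ∪ₜ x₂ ∪ₜ x₃ ≐ b ∷ []) φ)} →
        Holds (X₁ ∷ X₂ ∷ X₃ ∷ B ∷ []) φ
      sets φ {c} = by-truth-table _ φ {c} _ (cover ∷ [])
      transfer : ∀ {X} → X ⊆ B → lam (G ◁ A) (false ∷ B) ≤ lam (G ◁ A) (false ∷ X) → lam G B ≤ lam G X
      transfer X⊆B = subst₂ _≤_ (lam-◁ G A⊆E B⊆E─A) (lam-◁ G A⊆E (B⊆E─A ∘ X⊆B))

    absorbs⇒dominated : TriWellLinked (G ◁ A) (true ∷ B) → ∀ {X Y Z} →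
      Disjoint X Y → Disjoint X Z → Disjoint Y Z → X ∪ Y ∪ Z ≡ B ∪ A → Absorbs G A X Y Z →
      lam G (B ∪ A) ≤ lam G X ⊎ lam G (B ∪ A) ≤ lam G Y ⊎ lam G (B ∪ A) ≤ lam G Z
    absorbs⇒dominated twlB {X} {Y} {Z} dXY dXZ dYZ cover (t≤pX , t≤qY , t≤qZ) =
      Sum.map (dominated (true ∷ (X ─ A)) (lam-◁-eA-─ G t≤pX))
        (Sum.map (dominated (false ∷ (Y ─ A)) (lam-◁-─ G A⊆E (sets (y ⊑ e)) t≤qY))
                 (dominated (false ∷ (Z ─ A)) (lam-◁-─ G A⊆E (sets (z ⊑ e)) t≤qZ)))
        (twlB (true ∷ (X ─ A)) (false ∷ (Y ─ A)) (false ∷ (Z ─ A))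
              (cong (false ∷_) (sets ((x ─ₜ a) ∩ₜ (y ─ₜ a) ≐ ∅ₜ)))
              (cong (false ∷_) (sets ((x ─ₜ a) ∩ₜ (z ─ₜ a) ≐ ∅ₜ)))
              (cong (false ∷_) (sets ((y ─ₜ a) ∩ₜ (z ─ₜ a) ≐ ∅ₜ)))
              (cong (true ∷_) (sets ((x ─ₜ a) ∪ₜ (y ─ₜ a) ∪ₜ (z ─ₜ a) ≐ b))))
      where
      x y z b a e : Term 6
      x = var (# 0)
      y = var (# 1)
      z = var (# 2)
      b = var (# 3)
      a = var (# 4)
      e = var (# 5)
      known : List (Fact 6)
      known = a ⊑ e ∷ b ⊑ e ─ₜ a ∷ x ∩ₜ y ≐ ∅ₜ ∷ x ∩ₜ z ≐ ∅ₜ ∷ y ∩ₜ z ≐ ∅ₜ ∷ x ∪ₜ y ∪ₜ z ≐ b ∪ₜ a ∷ []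
      sets : (φ : Fact 6) {_ : False (counterexample? known φ)} → Holds (X ∷ Y ∷ Z ∷ B ∷ A ∷ E G ∷ []) φ
      sets φ {c} = by-truth-table _ φ {c} _ (A⊆E ∷ B⊆E─A ∷ dXY ∷ dXZ ∷ dYZ ∷ cover ∷ [])
      dominated : ∀ D {W} → lam (G ◁ A) D ≤ lam G W →
        lam (G ◁ A) (true ∷ B) ≤ lam (G ◁ A) D → lam G (B ∪ A) ≤ lam G W
      dominated _ D≤W B≤D = ≤-trans (≤-reflexive (sym (lam-◁-eA G A B))) (≤-trans B≤D D≤W)

    twl-◁-eA : TriWellLinked G A → TriWellLinked (G ◁ A) (true ∷ B) → TriWellLinked G (B ∪ A)
    twl-◁-eA twlA twlB X₁ X₂ X₃ d₁₂ d₁₃ d₂₃ cover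
      with twl-absorbs twlA d₁₂ d₁₃ d₂₃ (⊆-reflexive (sym cover) ∘ q⊆p∪q B A)
    ... | inj₁ X₁-absorbs = absorbs⇒dominated twlB d₁₂ d₁₃ d₂₃ cover X₁-absorbs
    ... | inj₂ (inj₁ X₂-absorbs) =
      assocʳ (map₁ swap (assocˡ (absorbs⇒dominated twlB (trans (∩-comm X₂ X₁) d₁₂) d₂₃ d₁₃
                                   (trans (∪.x∙yz≈y∙xz X₂ X₁ X₃) cover) X₂-absorbs)))
    ... | inj₂ (inj₂ X₃-absorbs) =
      assocʳ (swap (absorbs⇒dominated twlB (trans (∩-comm X₃ X₁) d₁₃) (trans (∩-comm X₃ X₂) d₂₃) d₁₂
                                      (trans (∪.x∙yz≈y∙zx X₃ X₁ X₂) cover) X₃-absorbs))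

lemma6p5 : ∀ {n m} (G : Hypergraph n m) (A : Subset m) (B : Subset (suc m)) →
    WellFormed G →
    A ⊆ E G → TriWellLinked G A →
    B ⊆ E (G ◁ A) → TriWellLinked (G ◁ A) B →
    TriWellLinked G (B ▷ A)
-- λ only depends on the incidences.
lemma6p5 G A (false ∷ B) _ A⊆E _ B⊆E◁A twlB = twl-◁ G A⊆E (drop-∷-⊆ B⊆E◁A) twlB
lemma6p5 G A (true ∷ B) _ A⊆E twlA B⊆E◁A twlB = twl-◁-eA G A⊆E (drop-∷-⊆ B⊆E◁A) twlA twlB
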